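{- Fix $\varepsilon \geq 0$, integers $1 \leq t \leq s$, and reals $a_1, \ldots, a_s, b_1, \ldots, b_s \geq 0$ such that: - $a_1 \geq a_2 \geq \cdots \geq a_s \geq 0$; - $\sum_{i=1}^s a_i = n_1$ and $\sum_{i=1}^s b_i = n_2 > 0$; - $a_i + b_i \leq (n_1+n_2)/t$ for all $i \in [s]$; - $\sum_{i=1}^s a_i b_i \geq (1-\varepsilon) n_1 n_2 / t$. Let $a := a_{t+1} + \cdots + a_s$. Then $$a \leq \varepsilon n_1 \frac{n_1+n_2}{n_2}.$$ In particular, if $n_1 \leq n_2$, then $a \leq 2\varepsilon n_1$.
   Context: $[s]=\{1,\dots,s\}$. -}

module Defs where

open import Level using (Level; _⊔_; suc)
open import Algebra.Bundles using (CommutativeRing)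
open import Relation.Binary.Structures using (IsTotalOrder)
open import Relation.Nullary using (¬_)
open import Relation.Nullary.Decidable using (⌊_⌋)
open import Data.Bool using (if_then_else_)
open import Data.Nat as ℕ using (ℕ; zero)
open import Data.Fin using (Fin; toℕ)
import Data.Fin as Fin

-- An ordered field (the paper works in ℝ; we state the lemma for every
-- ordered field, ℝ being an instance).  The inverse is total, with the
-- convention that only x ≉ 0 is constrained (as in Mathlib: 0⁻¹ arbitrary).
record OrderedField (c ℓ₁ ℓ₂ : Level) : Set (Level.suc (c ⊔ ℓ₁ ⊔ ℓ₂)) where
  field
    commutativeRing : CommutativeRing c ℓ₁
  open CommutativeRing commutativeRing public
  infix 4 _≤_
  infixl 7 _/_
  field
    _≤_          : Carrier → Carrier → Set ℓ₂
    isTotalOrder : IsTotalOrder _≈_ _≤_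
    +-monoˡ-≤    : ∀ {x y} z → x ≤ y → x + z ≤ y + z
    *-nonneg     : ∀ {x y} → 0# ≤ x → 0# ≤ y → 0# ≤ x * y
    0≉1          : ¬ (0# ≈ 1#)
    _⁻¹          : Carrier → Carrier
    ⁻¹-inverse   : ∀ x → ¬ (x ≈ 0#) → x * (x ⁻¹) ≈ 1#

  _<_ : Carrier → Carrier → Set (ℓ₁ ⊔ ℓ₂)
  x < y = (x ≤ y) Data.Product.× ¬ (x ≈ y)
    where import Data.Product

  _/_ : Carrier → Carrier → Carrier
  x / y = x * (y ⁻¹)

  fromℕ : ℕ → Carrier
  fromℕ zero        = 0#
  fromℕ (ℕ.suc n)   = 1# + fromℕ n

  sumFin : (n : ℕ) → (Fin n → Carrier) → Carrier
  sumFin zero      f = 0#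
  sumFin (ℕ.suc n) f = f Fin.zero + sumFin n (λ i → f (Fin.suc i))

  -- Σ over indices i (0-based) with t ≤ i, i.e. f_{t+1} + ... + f_s in
  -- 1-based notation
  sumFrom : (t n : ℕ) → (Fin n → Carrier) → Carrier
  sumFrom t n f = sumFin n (λ i → if ⌊ t ℕ.≤? toℕ i ⌋ then f i else 0#)

-- Split the indices into the head i < t and the tail i ≥ t, let X = a₁ + ⋯ + a_t
-- and let m = a_t, so that a_i ≤ m on the tail.  With N = n₁ + n₂ the heart of
-- the matter is the estimate
--     N · t · Σ aᵢbᵢ ≤ n₁² n₂ + n₂² X,
-- which together with t Σ aᵢbᵢ ≥ (1 - ε) n₁ n₂ and X = n₁ - a gives n₂ a ≤ ε n₁ N.
-- On the head the cap reads x + y ≤ N for x = t aᵢ, y = t bᵢ, and yields two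
-- termwise bounds: Cauchy–Schwarz, N x y ≤ n₂² x + n₁² y, and, from
-- (x - t m)(N - x - y) ≥ 0 and (x - n₁)² ≥ 0, a bound affine in x and y.  On the
-- tail aᵢbᵢ ≤ m bᵢ.  If N t m ≤ n₁² the tail terms are absorbed by the first head
-- bound; otherwise the second head bound, summed, closes the estimate.
module Submission where

open import Defs
open import Level using (Level)
open import Data.Product using (_×_; _,_; proj₁; Σ-syntax)
open import Data.Sum using (inj₁; inj₂; [_,_]′)
open import Data.Empty using (⊥-elim)
open import Relation.Nullary using (¬_; yes; no)
open import Relation.Nullary.Decidable using (⌊_⌋)
open import Data.Bool using (if_then_else_; true; false)
open import Relation.Binary.Bundles using (Poset)
open import Relation.Binary.Structures using (IsTotalOrder)
import Relation.Binary.PropositionalEquality as ≡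
open import Data.Nat as ℕ using (ℕ; zero; suc; z≤n; s≤s)
import Data.Nat.Properties as ℕₚ
open import Data.Fin using (Fin; toℕ)
import Data.Fin as Fin
import Data.Fin.Properties as Finₚ
import Algebra.Properties.Ring as RingProperties
import Algebra.Properties.CommutativeSemigroup as CommutativeSemigroupProperties
import Algebra.Solver.Ring.NaturalCoefficients.Default as Solver
import Relation.Binary.Reasoning.PartialOrder as PosetReasoning

module OrderedFieldProperties {c ℓ₁ ℓ₂ : Level} (F : OrderedField c ℓ₁ ℓ₂) where

  open OrderedField F
  open RingProperties ring using (xyx⁻¹≈y)
  open CommutativeSemigroupProperties *-commutativeSemigroup using (x∙yz≈y∙xz)
  open CommutativeSemigroupProperties +-commutativeSemigroup using () renaming (interchange to +-interchange)
  open Solver commutativeSemiring using (solve; _:=_; _:+_; _:*_; con)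

  poset : Poset c ℓ₁ ℓ₂
  poset = record { isPartialOrder = IsTotalOrder.isPartialOrder isTotalOrder }

  open Poset poset public using (≤-respʳ-≈)
    renaming (reflexive to ≤-reflexive; antisym to ≤-antisym)
  open IsTotalOrder isTotalOrder using (total)
  open PosetReasoning poset

  -- Ordered field arithmetic

  x+[y-x]≈y : ∀ x y → x + (y - x) ≈ y
  x+[y-x]≈y x y = trans (sym (+-assoc x y (- x))) (xyx⁻¹≈y x y)

  +-monoʳ-≤ : ∀ x {y z} → y ≤ z → x + y ≤ x + z
  +-monoʳ-≤ x {y} {z} y≤z = begin
    x + y  ≈⟨ +-comm x y ⟩
    y + x  ≤⟨ +-monoˡ-≤ x y≤z ⟩
    z + x  ≈⟨ +-comm z x ⟩
    x + z  ∎

  +-mono-≤ : ∀ {x y u v} → x ≤ y → u ≤ v → x + u ≤ y + v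
  +-mono-≤ {x} {y} {u} {v} x≤y u≤v = begin
    x + u  ≤⟨ +-monoˡ-≤ u x≤y ⟩
    y + u  ≤⟨ +-monoʳ-≤ y u≤v ⟩
    y + v  ∎

  +-cancelʳ-≤ : ∀ z {x y} → x + z ≤ y + z → x ≤ y
  +-cancelʳ-≤ z {x} {y} x+z≤y+z = begin
    x            ≈⟨ x+y-y≈x x ⟨
    x + z + - z  ≤⟨ +-monoˡ-≤ (- z) x+z≤y+z ⟩
    y + z + - z  ≈⟨ x+y-y≈x y ⟩
    y            ∎
    where
    x+y-y≈x : ∀ x → x + z + - z ≈ x
    x+y-y≈x x = trans (+-assoc x z (- z)) (trans (+-congˡ (-‿inverseʳ z)) (+-identityʳ x))

  x≤x+y : ∀ {x y} → 0# ≤ y → x ≤ x + y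
  x≤x+y {x} {y} 0≤y = begin
    x       ≈⟨ +-identityʳ x ⟨
    x + 0#  ≤⟨ +-monoʳ-≤ x 0≤y ⟩
    x + y   ∎

  +-nonneg : ∀ {x y} → 0# ≤ x → 0# ≤ y → 0# ≤ x + y
  +-nonneg {x} {y} 0≤x 0≤y = begin
    0#     ≤⟨ 0≤x ⟩
    x      ≤⟨ x≤x+y 0≤y ⟩
    x + y  ∎

  ≤-difference : ∀ {x y} → x ≤ y → Σ[ d ∈ Carrier ] (0# ≤ d × x + d ≈ y)
  ≤-difference {x} {y} x≤y = y - x , 0≤y-x , x+[y-x]≈y x y
    where
    0≤y-x : 0# ≤ y - x
    0≤y-x = begin
      0#     ≈⟨ -‿inverseʳ x ⟨
      x - x  ≤⟨ +-monoˡ-≤ (- x) x≤y ⟩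
      y - x  ∎

  *-monoˡ-≤-nonneg : ∀ {z x y} → 0# ≤ z → x ≤ y → z * x ≤ z * y
  *-monoˡ-≤-nonneg {z} {x} {y} 0≤z x≤y with ≤-difference x≤y
  ... | d , 0≤d , x+d≈y = begin
    z * x          ≤⟨ x≤x+y (*-nonneg 0≤z 0≤d) ⟩
    z * x + z * d  ≈⟨ distribˡ z x d ⟨
    z * (x + d)    ≈⟨ *-congˡ x+d≈y ⟩
    z * y          ∎

  *-monoʳ-≤-nonneg : ∀ {z x y} → 0# ≤ z → x ≤ y → x * z ≤ y * z
  *-monoʳ-≤-nonneg {z} {x} {y} 0≤z x≤y = begin
    x * z  ≈⟨ *-comm x z ⟩
    z * x  ≤⟨ *-monoˡ-≤-nonneg 0≤z x≤y ⟩
    z * y  ≈⟨ *-comm z y ⟩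
    y * z  ∎

  rearrangement : ∀ {x y u v} → x ≤ y → u ≤ v → x * v + y * u ≤ x * u + y * v
  rearrangement {x} {y} {u} {v} x≤y u≤v with ≤-difference x≤y | ≤-difference u≤v
  ... | d , 0≤d , x+d≈y | e , 0≤e , u+e≈v = begin
    x * v + y * u                      ≈⟨ +-cong (*-congˡ u+e≈v) (*-congʳ x+d≈y) ⟨
    x * (u + e) + (x + d) * u          ≤⟨ x≤x+y (*-nonneg 0≤d 0≤e) ⟩
    x * (u + e) + (x + d) * u + d * e  ≈⟨ expand x u d e ⟩
    x * u + (x + d) * (u + e)          ≈⟨ +-congˡ (*-cong x+d≈y u+e≈v) ⟩
    x * u + y * v                      ∎
    where
    expand : ∀ x u d e → x * (u + e) + (x + d) * u + d * e ≈ x * u + (x + d) * (u + e)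
    expand = solve 4 (λ x u d e →
      x :* (u :+ e) :+ (x :+ d) :* u :+ d :* e := x :* u :+ (x :+ d) :* (u :+ e)) refl

  x*y+x*y≤x*x+y*y : ∀ x y → x * y + x * y ≤ x * x + y * y
  x*y+x*y≤x*x+y*y x y with total x y
  ... | inj₁ x≤y = begin
    x * y + x * y  ≈⟨ +-congˡ (*-comm x y) ⟩
    x * y + y * x  ≤⟨ rearrangement x≤y x≤y ⟩
    x * x + y * y  ∎
  ... | inj₂ y≤x = begin
    x * y + x * y  ≈⟨ +-congʳ (*-comm x y) ⟩
    y * x + x * y  ≤⟨ rearrangement y≤x y≤x ⟩
    y * y + x * x  ≈⟨ +-comm (y * y) (x * x) ⟩
    x * x + y * y  ∎

  x*x-nonneg : ∀ x → 0# ≤ x * x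
  x*x-nonneg x = begin
    0#                ≈⟨ +-identityʳ 0# ⟨
    0# + 0#           ≈⟨ +-cong (zeroʳ x) (zeroʳ x) ⟨
    x * 0# + x * 0#   ≤⟨ x*y+x*y≤x*x+y*y x 0# ⟩
    x * x + 0# * 0#   ≈⟨ +-congˡ (zeroʳ 0#) ⟩
    x * x + 0#        ≈⟨ +-identityʳ (x * x) ⟩
    x * x             ∎

  0≤1 : 0# ≤ 1#
  0≤1 = ≤-respʳ-≈ (*-identityʳ 1#) (x*x-nonneg 1#)

  <-respʳ-≈ : ∀ {x y z} → x ≈ y → z < x → z < y
  <-respʳ-≈ x≈y (z≤x , z≉x) = ≤-respʳ-≈ x≈y z≤x , λ z≈y → z≉x (trans z≈y (sym x≈y))

  0<1+x : ∀ {x} → 0# ≤ x → 0# < (1# + x)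
  0<1+x {x} 0≤x = +-nonneg 0≤1 0≤x , λ 0≈1+x → 0≉1 (≤-antisym 0≤1 (≤-respʳ-≈ (sym 0≈1+x) (x≤x+y 0≤x)))

  +-pos : ∀ {x y} → 0# ≤ x → 0# < y → 0# < (x + y)
  +-pos {x} {y} 0≤x (0≤y , 0≉y) = +-nonneg 0≤x 0≤y , λ 0≈x+y → 0≉y (≤-antisym 0≤y (y≤0 0≈x+y))
    where
    y≤0 : 0# ≈ x + y → y ≤ 0#
    y≤0 0≈x+y = ≤-respʳ-≈ (trans (+-comm y x) (sym 0≈x+y)) (x≤x+y 0≤x)

  fromℕ-nonneg : ∀ n → 0# ≤ fromℕ n
  fromℕ-nonneg zero    = ≤-reflexive refl
  fromℕ-nonneg (suc n) = +-nonneg 0≤1 (fromℕ-nonneg n)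

  fromℕ-suc-pos : ∀ n → 0# < fromℕ (suc n)
  fromℕ-suc-pos n = 0<1+x (fromℕ-nonneg n)

  [x*y]/x≈y : ∀ {x} y → ¬ (x ≈ 0#) → (x * y) / x ≈ y
  [x*y]/x≈y {x} y x≉0 = begin-equality
    x * y * x ⁻¹    ≈⟨ trans (*-assoc x y (x ⁻¹)) (x∙yz≈y∙xz x y (x ⁻¹)) ⟩
    y * (x * x ⁻¹)  ≈⟨ *-congˡ (⁻¹-inverse x x≉0) ⟩
    y * 1#          ≈⟨ *-identityʳ y ⟩
    y               ∎

  x*[y/x]≈y : ∀ {x} y → ¬ (x ≈ 0#) → x * (y / x) ≈ y
  x*[y/x]≈y {x} y x≉0 = trans (sym (*-assoc x y (x ⁻¹))) ([x*y]/x≈y y x≉0)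

  pos⇒≉0 : ∀ {x} → 0# < x → ¬ (x ≈ 0#)
  pos⇒≉0 (_ , 0≉x) x≈0 = 0≉x (sym x≈0)

  ⁻¹-nonneg : ∀ {x} → 0# < x → 0# ≤ x ⁻¹
  ⁻¹-nonneg {x} 0<x@(0≤x , _) with total 0# (x ⁻¹)
  ... | inj₁ 0≤x⁻¹ = 0≤x⁻¹
  ... | inj₂ x⁻¹≤0 = ⊥-elim (0≉1 (≤-antisym 0≤1 (begin
    1#          ≈⟨ ⁻¹-inverse x (pos⇒≉0 0<x) ⟨
    x * x ⁻¹    ≤⟨ *-monoˡ-≤-nonneg 0≤x x⁻¹≤0 ⟩
    x * 0#      ≈⟨ zeroʳ x ⟩
    0#          ∎)))

  *-cancelˡ-≤-pos : ∀ {z x y} → 0# < z → z * x ≤ z * y → x ≤ y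
  *-cancelˡ-≤-pos {z} {x} {y} 0<z zx≤zy = begin
    x           ≈⟨ [x*y]/x≈y x (pos⇒≉0 0<z) ⟨
    z * x / z   ≤⟨ *-monoʳ-≤-nonneg (⁻¹-nonneg 0<z) zx≤zy ⟩
    z * y / z   ≈⟨ [x*y]/x≈y y (pos⇒≉0 0<z) ⟩
    y           ∎

  x≤y/z⇒z*x≤y : ∀ {x y z} → 0# < z → x ≤ y / z → z * x ≤ y
  x≤y/z⇒z*x≤y {x} {y} {z} 0<z x≤y/z = begin
    z * x        ≤⟨ *-monoˡ-≤-nonneg (proj₁ 0<z) x≤y/z ⟩
    z * (y / z)  ≈⟨ x*[y/x]≈y y (pos⇒≉0 0<z) ⟩
    y            ∎

  x/z≤y⇒x≤z*y : ∀ {x y z} → 0# < z → x / z ≤ y → x ≤ z * y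
  x/z≤y⇒x≤z*y {x} {y} {z} 0<z x/z≤y = begin
    x            ≈⟨ x*[y/x]≈y x (pos⇒≉0 0<z) ⟨
    z * (x / z)  ≤⟨ *-monoˡ-≤-nonneg (proj₁ 0<z) x/z≤y ⟩
    z * y        ∎

  z*x≤y⇒x≤y/z : ∀ {x y z} → 0# < z → z * x ≤ y → x ≤ y / z
  z*x≤y⇒x≤y/z {x} {y} {z} 0<z zx≤y = *-cancelˡ-≤-pos 0<z (begin
    z * x        ≤⟨ zx≤y ⟩
    y            ≈⟨ x*[y/x]≈y y (pos⇒≉0 0<z) ⟨
    z * (y / z)  ∎)

  -- Termwise bounds under the cap x + y ≤ N

  cauchy-schwarz₂ : ∀ p q x y → (p + q) * (p + q) * (x * y) ≤ (q * q * x + p * p * y) * (x + y)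
  cauchy-schwarz₂ p q x y = begin
    (p + q) * (p + q) * (x * y)                                      ≈⟨ expandˡ p q x y ⟩
    q * x * (p * y) + q * x * (p * y) + (p * p + q * q) * (x * y)    ≤⟨ +-monoˡ-≤ _ (x*y+x*y≤x*x+y*y (q * x) (p * y)) ⟩
    q * x * (q * x) + p * y * (p * y) + (p * p + q * q) * (x * y)    ≈⟨ expandʳ p q x y ⟩
    (q * q * x + p * p * y) * (x + y)                                ∎
    where
    expandˡ : ∀ p q x y → (p + q) * (p + q) * (x * y) ≈ q * x * (p * y) + q * x * (p * y) + (p * p + q * q) * (x * y)
    expandˡ = solve 4 (λ p q x y → (p :+ q) :* (p :+ q) :* (x :* y)
      := q :* x :* (p :* y) :+ q :* x :* (p :* y) :+ (p :* p :+ q :* q) :* (x :* y)) refl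
    expandʳ : ∀ p q x y → q * x * (q * x) + p * y * (p * y) + (p * p + q * q) * (x * y) ≈ (q * q * x + p * p * y) * (x + y)
    expandʳ = solve 4 (λ p q x y → q :* x :* (q :* x) :+ p :* y :* (p :* y) :+ (p :* p :+ q :* q) :* (x :* y)
      := (q :* q :* x :+ p :* p :* y) :* (x :+ y)) refl

  cap-bound-cauchy : ∀ {p q x y} → 0# < (p + q) → 0# ≤ x → 0# ≤ y → x + y ≤ p + q →
                     (p + q) * (x * y) ≤ q * q * x + p * p * y
  cap-bound-cauchy {p} {q} {x} {y} 0<p+q 0≤x 0≤y x+y≤p+q = *-cancelˡ-≤-pos 0<p+q (begin
    (p + q) * ((p + q) * (x * y))        ≈⟨ *-assoc (p + q) (p + q) (x * y) ⟨
    (p + q) * (p + q) * (x * y)          ≤⟨ cauchy-schwarz₂ p q x y ⟩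
    (q * q * x + p * p * y) * (x + y)    ≤⟨ *-monoˡ-≤-nonneg 0≤R x+y≤p+q ⟩
    (q * q * x + p * p * y) * (p + q)    ≈⟨ *-comm _ (p + q) ⟩
    (p + q) * (q * q * x + p * p * y)    ∎)
    where
    0≤R : 0# ≤ q * q * x + p * p * y
    0≤R = +-nonneg (*-nonneg (x*x-nonneg q) 0≤x) (*-nonneg (x*x-nonneg p) 0≤y)

  cap-bound-affine : ∀ {M N x y} ν → M ≤ x → x + y ≤ N →
                     x * y + (ν + ν) * x + M * N ≤ (M + N) * x + M * y + ν * ν
  cap-bound-affine {M} {N} {x} {y} ν M≤x x+y≤N = +-cancelʳ-≤ (x * x) (begin
    x * y + (ν + ν) * x + M * N + x * x          ≈⟨ regroupˡ x y ν M N ⟩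
    (M * N + x * (x + y)) + (ν * x + ν * x)      ≤⟨ +-mono-≤ (rearrangement M≤x x+y≤N) (x*y+x*y≤x*x+y*y ν x) ⟩
    (M * (x + y) + x * N) + (ν * ν + x * x)      ≈⟨ regroupʳ x y ν M N ⟩
    (M + N) * x + M * y + ν * ν + x * x          ∎)
    where
    regroupˡ : ∀ x y ν M N → x * y + (ν + ν) * x + M * N + x * x ≈ (M * N + x * (x + y)) + (ν * x + ν * x)
    regroupˡ = solve 5 (λ x y ν M N → x :* y :+ (ν :+ ν) :* x :+ M :* N :+ x :* x
      := (M :* N :+ x :* (x :+ y)) :+ (ν :* x :+ ν :* x)) refl
    regroupʳ : ∀ x y ν M N → (M * (x + y) + x * N) + (ν * ν + x * x) ≈ (M + N) * x + M * y + ν * ν + x * x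
    regroupʳ = solve 5 (λ x y ν M N → (M :* (x :+ y) :+ x :* N) :+ (ν :* ν :+ x :* x)
      := (M :+ N) :* x :+ M :* y :+ ν :* ν :+ x :* x) refl

  -- Finite sums

  sumFin-cong : ∀ n {f g : Fin n → Carrier} → (∀ i → f i ≈ g i) → sumFin n f ≈ sumFin n g
  sumFin-cong zero    f≈g = refl
  sumFin-cong (suc n) f≈g = +-cong (f≈g Fin.zero) (sumFin-cong n (λ i → f≈g (Fin.suc i)))

  sumFin-mono : ∀ n {f g : Fin n → Carrier} → (∀ i → f i ≤ g i) → sumFin n f ≤ sumFin n g
  sumFin-mono zero    f≤g = ≤-reflexive refl
  sumFin-mono (suc n) f≤g = +-mono-≤ (f≤g Fin.zero) (sumFin-mono n (λ i → f≤g (Fin.suc i)))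

  sumFin-nonneg : ∀ n {f : Fin n → Carrier} → (∀ i → 0# ≤ f i) → 0# ≤ sumFin n f
  sumFin-nonneg zero    0≤f = ≤-reflexive refl
  sumFin-nonneg (suc n) 0≤f = +-nonneg (0≤f Fin.zero) (sumFin-nonneg n (λ i → 0≤f (Fin.suc i)))

  sumFin-+ : ∀ n (f g : Fin n → Carrier) → sumFin n (λ i → f i + g i) ≈ sumFin n f + sumFin n g
  sumFin-+ zero    f g = sym (+-identityʳ 0#)
  sumFin-+ (suc n) f g = trans (+-congˡ (sumFin-+ n (λ i → f (Fin.suc i)) (λ i → g (Fin.suc i))))
                               (+-interchange (f Fin.zero) (g Fin.zero) _ _)

  sumFin-*ˡ : ∀ n k (f : Fin n → Carrier) → sumFin n (λ i → k * f i) ≈ k * sumFin n f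
  sumFin-*ˡ zero    k f = sym (zeroʳ k)
  sumFin-*ˡ (suc n) k f = trans (+-congˡ (sumFin-*ˡ n k (λ i → f (Fin.suc i)))) (sym (distribˡ k _ _))

  sumFin-const : ∀ n k → sumFin n (λ _ → k) ≈ fromℕ n * k
  sumFin-const zero    k = sym (zeroˡ k)
  sumFin-const (suc n) k = begin-equality
    k + sumFin n (λ _ → k)   ≈⟨ +-cong (sym (*-identityˡ k)) (sumFin-const n k) ⟩
    1# * k + fromℕ n * k     ≈⟨ distribʳ k 1# (fromℕ n) ⟨
    (1# + fromℕ n) * k       ∎

  sumFin-linear : ∀ n p q (f g : Fin n → Carrier) →
                  sumFin n (λ i → p * f i + q * g i) ≈ p * sumFin n f + q * sumFin n g
  sumFin-linear n p q f g =
    trans (sumFin-+ n (λ i → p * f i) (λ i → q * g i)) (+-cong (sumFin-*ˡ n p f) (sumFin-*ˡ n q g))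

  sumFin-affine : ∀ n (f g : Fin n → Carrier) k c →
                  sumFin n (λ i → f i + k * g i + c) ≈ sumFin n f + k * sumFin n g + fromℕ n * c
  sumFin-affine n f g k c = begin-equality
    sumFin n (λ i → f i + k * g i + c)                   ≈⟨ sumFin-+ n (λ i → f i + k * g i) (λ _ → c) ⟩
    sumFin n (λ i → f i + k * g i) + sumFin n (λ _ → c)  ≈⟨ +-cong (sumFin-+ n f (λ i → k * g i)) (sumFin-const n c) ⟩
    sumFin n f + sumFin n (λ i → k * g i) + fromℕ n * c  ≈⟨ +-congʳ (+-congˡ (sumFin-*ˡ n k g)) ⟩
    sumFin n f + k * sumFin n g + fromℕ n * c            ∎

  ⌊suc≤?suc⌋ : ∀ m n → ⌊ suc m ℕ.≤? suc n ⌋ ≡.≡ ⌊ m ℕ.≤? n ⌋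
  ⌊suc≤?suc⌋ m n with suc m ℕ.≤? suc n | m ℕ.≤? n
  ... | yes _     | yes _   = ≡.refl
  ... | no  _     | no  _   = ≡.refl
  ... | yes 1+m≤1+n | no  m≰n = ⊥-elim (m≰n (ℕ.s≤s⁻¹ 1+m≤1+n))
  ... | no  1+m≰1+n | yes m≤n = ⊥-elim (1+m≰1+n (s≤s m≤n))

  sumFrom-suc : ∀ t n (f : Fin (suc n) → Carrier) → sumFrom (suc t) (suc n) f ≈ sumFrom t n (λ i → f (Fin.suc i))
  sumFrom-suc t n f = trans (+-congˡ (sumFin-cong n tail≈)) (+-identityˡ _)
    where
    tail≈ : ∀ i → (if ⌊ suc t ℕ.≤? suc (toℕ i) ⌋ then f (Fin.suc i) else 0#)
                ≈ (if ⌊ t ℕ.≤? toℕ i ⌋ then f (Fin.suc i) else 0#)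
    tail≈ i = reflexive (≡.cong (λ b → if b then f (Fin.suc i) else 0#) (⌊suc≤?suc⌋ t (toℕ i)))

  sumFin-split : ∀ {t n} (t≤n : t ℕ.≤ n) (f : Fin n → Carrier) →
                 sumFin n f ≈ sumFin t (λ i → f (Fin.inject≤ i t≤n)) + sumFrom t n f
  sumFin-split z≤n f = sym (+-identityˡ _)
  sumFin-split {suc t} {suc n} (s≤s t≤n) f = begin-equality
    f Fin.zero + sumFin n f′                                   ≈⟨ +-congˡ (sumFin-split t≤n f′) ⟩
    f Fin.zero + (sumFin t (λ i → f′ (Fin.inject≤ i t≤n)) + sumFrom t n f′)
                                                               ≈⟨ +-assoc _ _ _ ⟨
    f Fin.zero + sumFin t (λ i → f′ (Fin.inject≤ i t≤n)) + sumFrom t n f′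
                                                               ≈⟨ +-congˡ (sumFrom-suc t n f) ⟨
    f Fin.zero + sumFin t (λ i → f′ (Fin.inject≤ i t≤n)) + sumFrom (suc t) (suc n) f
                                                               ∎
    where
    f′ : Fin n → Carrier
    f′ i = f (Fin.suc i)

  if-nonneg : ∀ b {x} → 0# ≤ x → 0# ≤ (if b then x else 0#)
  if-nonneg true  0≤x = 0≤x
  if-nonneg false 0≤x = ≤-reflexive refl

  sumFrom-nonneg : ∀ t n {f : Fin n → Carrier} → (∀ i → 0# ≤ f i) → 0# ≤ sumFrom t n f
  sumFrom-nonneg t n 0≤f = sumFin-nonneg n (λ i → if-nonneg _ (0≤f i))

  sumFrom-*-≤ : ∀ t n {m} (f g : Fin n → Carrier) → (∀ i → t ℕ.≤ toℕ i → f i ≤ m) → (∀ i → 0# ≤ g i) →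
                sumFrom t n (λ i → f i * g i) ≤ m * sumFrom t n g
  sumFrom-*-≤ t n {m} f g f≤m 0≤g = begin
    sumFrom t n (λ i → f i * g i)                                   ≤⟨ sumFin-mono n termwise ⟩
    sumFin n (λ i → m * (if ⌊ t ℕ.≤? toℕ i ⌋ then g i else 0#))     ≈⟨ sumFin-*ˡ n m _ ⟩
    m * sumFrom t n g                                               ∎
    where
    termwise : ∀ i → (if ⌊ t ℕ.≤? toℕ i ⌋ then f i * g i else 0#) ≤ m * (if ⌊ t ℕ.≤? toℕ i ⌋ then g i else 0#)
    termwise i with t ℕ.≤? toℕ i
    ... | yes t≤i = *-monoʳ-≤-nonneg (0≤g i) (f≤m i t≤i)
    ... | no  _   = ≤-reflexive (sym (zeroʳ m))

  sum-cap-bound-cauchy : ∀ n (x y : Fin n → Carrier) {p q} → 0# < (p + q) →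
                         (∀ i → 0# ≤ x i) → (∀ i → 0# ≤ y i) → (∀ i → x i + y i ≤ p + q) →
                         (p + q) * sumFin n (λ i → x i * y i) ≤ q * q * sumFin n x + p * p * sumFin n y
  sum-cap-bound-cauchy n x y {p} {q} 0<p+q 0≤x 0≤y cap = begin
    (p + q) * sumFin n (λ i → x i * y i)              ≈⟨ sumFin-*ˡ n (p + q) _ ⟨
    sumFin n (λ i → (p + q) * (x i * y i))            ≤⟨ sumFin-mono n (λ i → cap-bound-cauchy 0<p+q (0≤x i) (0≤y i) (cap i)) ⟩
    sumFin n (λ i → q * q * x i + p * p * y i)        ≈⟨ sumFin-linear n (q * q) (p * p) x y ⟩
    q * q * sumFin n x + p * p * sumFin n y           ∎

  sum-cap-bound-affine : ∀ n (x y : Fin n → Carrier) {M N} ν → (∀ i → M ≤ x i) → (∀ i → x i + y i ≤ N) →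
                         sumFin n (λ i → x i * y i) + (ν + ν) * sumFin n x + fromℕ n * (M * N)
                         ≤ (M + N) * sumFin n x + M * sumFin n y + fromℕ n * (ν * ν)
  sum-cap-bound-affine n x y {M} {N} ν M≤x cap = begin
    sumFin n (λ i → x i * y i) + (ν + ν) * sumFin n x + fromℕ n * (M * N)
      ≈⟨ sumFin-affine n (λ i → x i * y i) x (ν + ν) (M * N) ⟨
    sumFin n (λ i → x i * y i + (ν + ν) * x i + M * N)
      ≤⟨ sumFin-mono n (λ i → cap-bound-affine ν (M≤x i) (cap i)) ⟩
    sumFin n (λ i → (M + N) * x i + M * y i + ν * ν)
      ≈⟨ sumFin-affine n (λ i → (M + N) * x i) y M (ν * ν) ⟩
    sumFin n (λ i → (M + N) * x i) + M * sumFin n y + fromℕ n * (ν * ν)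
      ≈⟨ +-congʳ (+-congʳ (sumFin-*ˡ n (M + N) x)) ⟩
    (M + N) * sumFin n x + M * sumFin n y + fromℕ n * (ν * ν)
      ∎

  -- The algebraic core

  key-inequality : ∀ {T M X A B₁ B₂ Sₕ Sₜ} → let n₁ = X + A; n₂ = B₁ + B₂; N = n₁ + n₂ in
    0# ≤ X → 0# ≤ A → 0# ≤ B₁ → 0# ≤ B₂ →
    N * (T * Sₕ) ≤ n₂ * n₂ * X + n₁ * n₁ * B₁ →
    T * Sₕ + (n₁ + n₁) * X + M * N ≤ (M + N) * X + M * B₁ + n₁ * n₁ →
    T * Sₜ ≤ M * B₂ →
    N * (T * (Sₕ + Sₜ)) ≤ n₁ * n₁ * n₂ + n₂ * n₂ * X
  key-inequality {T} {M} {X} {A} {B₁} {B₂} {Sₕ} {Sₜ} 0≤X 0≤A 0≤B₁ 0≤B₂ headᶜ headᵃ tail =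
    [ small-threshold , large-threshold ]′ (total (N * M) (n₁ * n₁))
    where
    n₁ n₂ N : Carrier
    n₁ = X + A
    n₂ = B₁ + B₂
    N = n₁ + n₂

    0≤N : 0# ≤ N
    0≤N = +-nonneg (+-nonneg 0≤X 0≤A) (+-nonneg 0≤B₁ 0≤B₂)

    small-threshold : N * M ≤ n₁ * n₁ → N * (T * (Sₕ + Sₜ)) ≤ n₁ * n₁ * n₂ + n₂ * n₂ * X
    small-threshold NM≤n₁n₁ = begin
      N * (T * (Sₕ + Sₜ))                          ≈⟨ trans (*-congˡ (distribˡ T Sₕ Sₜ)) (distribˡ N _ _) ⟩
      N * (T * Sₕ) + N * (T * Sₜ)                  ≤⟨ +-mono-≤ headᶜ (*-monoˡ-≤-nonneg 0≤N tail) ⟩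
      n₂ * n₂ * X + n₁ * n₁ * B₁ + N * (M * B₂)    ≈⟨ +-congˡ (*-assoc N M B₂) ⟨
      n₂ * n₂ * X + n₁ * n₁ * B₁ + N * M * B₂      ≤⟨ +-monoʳ-≤ _ (*-monoʳ-≤-nonneg 0≤B₂ NM≤n₁n₁) ⟩
      n₂ * n₂ * X + n₁ * n₁ * B₁ + n₁ * n₁ * B₂    ≈⟨ +-assoc _ _ _ ⟩
      n₂ * n₂ * X + (n₁ * n₁ * B₁ + n₁ * n₁ * B₂)  ≈⟨ +-congˡ (distribˡ (n₁ * n₁) B₁ B₂) ⟨
      n₂ * n₂ * X + n₁ * n₁ * n₂                   ≈⟨ +-comm _ _ ⟩
      n₁ * n₁ * n₂ + n₂ * n₂ * X                   ∎

    -- chosen so that the last step below is a polynomial identity once n₁ = X + A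
    C : Carrier
    C = N * ((n₁ + n₁) * X + M * N) + n₁ * n₁ * A

    large-threshold : n₁ * n₁ ≤ N * M → N * (T * (Sₕ + Sₜ)) ≤ n₁ * n₁ * n₂ + n₂ * n₂ * X
    large-threshold n₁n₁≤NM = +-cancelʳ-≤ C (begin
      N * (T * (Sₕ + Sₜ)) + C
        ≤⟨ +-monoʳ-≤ _ (+-monoʳ-≤ _ (*-monoʳ-≤-nonneg 0≤A n₁n₁≤NM)) ⟩
      N * (T * (Sₕ + Sₜ)) + (N * ((n₁ + n₁) * X + M * N) + N * M * A)
        ≈⟨ regroup ⟩
      N * (T * Sₕ + (n₁ + n₁) * X + M * N) + N * (T * Sₜ) + N * M * A
        ≤⟨ +-monoˡ-≤ _ (+-mono-≤ (*-monoˡ-≤-nonneg 0≤N headᵃ) (*-monoˡ-≤-nonneg 0≤N tail)) ⟩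
      N * ((M + N) * X + M * B₁ + n₁ * n₁) + N * (M * B₂) + N * M * A
        ≈⟨ expand ⟩
      n₁ * n₁ * n₂ + n₂ * n₂ * X + C
        ∎)
      where
      regroup : N * (T * (Sₕ + Sₜ)) + (N * ((n₁ + n₁) * X + M * N) + N * M * A)
                ≈ N * (T * Sₕ + (n₁ + n₁) * X + M * N) + N * (T * Sₜ) + N * M * A
      regroup = solve 7 (λ N T S S′ K L P → N :* (T :* (S :+ S′)) :+ (N :* (K :+ L) :+ P)
        := N :* (T :* S :+ K :+ L) :+ N :* (T :* S′) :+ P) refl N T Sₕ Sₜ ((n₁ + n₁) * X) (M * N) (N * M * A)
      expand : N * ((M + N) * X + M * B₁ + n₁ * n₁) + N * (M * B₂) + N * M * A
               ≈ n₁ * n₁ * n₂ + n₂ * n₂ * X + C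
      expand = solve 5 (λ M X A B₁ B₂ → let n₁ = X :+ A; n₂ = B₁ :+ B₂; N = n₁ :+ n₂ in
        N :* ((M :+ N) :* X :+ M :* B₁ :+ n₁ :* n₁) :+ N :* (M :* B₂) :+ N :* M :* A
        := n₁ :* n₁ :* n₂ :+ n₂ :* n₂ :* X :+ (N :* ((n₁ :+ n₁) :* X :+ M :* N) :+ n₁ :* n₁ :* A)) refl M X A B₁ B₂

  tail-mass-bound : ∀ {ε n₁ n₂ X A P} → 0# < n₂ → 0# ≤ n₁ + n₂ → X + A ≈ n₁ →
                    (1# - ε) * n₁ * n₂ ≤ P → (n₁ + n₂) * P ≤ n₁ * n₁ * n₂ + n₂ * n₂ * X →
                    n₂ * A ≤ ε * n₁ * (n₁ + n₂)
  tail-mass-bound {ε} {n₁} {n₂} {X} {A} {P} 0<n₂ 0≤N X+A≈n₁ lower upper =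
    *-cancelˡ-≤-pos 0<n₂ (+-cancelʳ-≤ (N * (u * n₁ * n₂)) (begin
      n₂ * (n₂ * A) + N * (u * n₁ * n₂)              ≤⟨ +-monoʳ-≤ _ (*-monoˡ-≤-nonneg 0≤N lower) ⟩
      n₂ * (n₂ * A) + N * P                          ≤⟨ +-monoʳ-≤ _ upper ⟩
      n₂ * (n₂ * A) + (n₁ * n₁ * n₂ + n₂ * n₂ * X)   ≈⟨ regroup n₁ n₂ X A ⟩
      n₂ * n₂ * (X + A) + n₁ * n₁ * n₂               ≈⟨ +-congʳ (*-congˡ X+A≈n₁) ⟩
      n₂ * n₂ * n₁ + n₁ * n₁ * n₂                    ≈⟨ factor n₁ n₂ ⟩
      N * n₁ * n₂ * 1#                               ≈⟨ *-congˡ (x+[y-x]≈y ε 1#) ⟨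
      N * n₁ * n₂ * (ε + u)                          ≈⟨ distribute ε u n₁ n₂ ⟩
      n₂ * (ε * n₁ * N) + N * (u * n₁ * n₂)          ∎))
    where
    N u : Carrier
    N = n₁ + n₂
    u = 1# - ε
    regroup : ∀ n₁ n₂ X A → n₂ * (n₂ * A) + (n₁ * n₁ * n₂ + n₂ * n₂ * X) ≈ n₂ * n₂ * (X + A) + n₁ * n₁ * n₂
    regroup = solve 4 (λ n₁ n₂ X A → n₂ :* (n₂ :* A) :+ (n₁ :* n₁ :* n₂ :+ n₂ :* n₂ :* X)
      := n₂ :* n₂ :* (X :+ A) :+ n₁ :* n₁ :* n₂) refl
    factor : ∀ n₁ n₂ → n₂ * n₂ * n₁ + n₁ * n₁ * n₂ ≈ (n₁ + n₂) * n₁ * n₂ * 1#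
    factor = solve 2 (λ n₁ n₂ → n₂ :* n₂ :* n₁ :+ n₁ :* n₁ :* n₂ := (n₁ :+ n₂) :* n₁ :* n₂ :* con 1) refl
    distribute : ∀ ε u n₁ n₂ → (n₁ + n₂) * n₁ * n₂ * (ε + u) ≈ n₂ * (ε * n₁ * (n₁ + n₂)) + (n₁ + n₂) * (u * n₁ * n₂)
    distribute = solve 4 (λ ε u n₁ n₂ → (n₁ :+ n₂) :* n₁ :* n₂ :* (ε :+ u)
      := n₂ :* (ε :* n₁ :* (n₁ :+ n₂)) :+ (n₁ :+ n₂) :* (u :* n₁ :* n₂)) refl

  tail-mass-bound-balanced : ∀ {ε n₁ n₂ A} → 0# < n₂ → 0# ≤ ε → 0# ≤ n₁ → n₁ ≤ n₂ →
                             n₂ * A ≤ ε * n₁ * (n₁ + n₂) → A ≤ fromℕ 2 * ε * n₁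
  tail-mass-bound-balanced {ε} {n₁} {n₂} {A} 0<n₂ 0≤ε 0≤n₁ n₁≤n₂ n₂A≤εn₁N = *-cancelˡ-≤-pos 0<n₂ (begin
    n₂ * A                  ≤⟨ n₂A≤εn₁N ⟩
    ε * n₁ * (n₁ + n₂)      ≤⟨ *-monoˡ-≤-nonneg (*-nonneg 0≤ε 0≤n₁) (+-monoˡ-≤ n₂ n₁≤n₂) ⟩
    ε * n₁ * (n₂ + n₂)      ≈⟨ double ε n₁ n₂ ⟩
    n₂ * (fromℕ 2 * ε * n₁) ∎)
    where
    double : ∀ ε n₁ n₂ → ε * n₁ * (n₂ + n₂) ≈ n₂ * (fromℕ 2 * ε * n₁)
    double = solve 3 (λ ε n₁ n₂ → ε :* n₁ :* (n₂ :+ n₂) := n₂ :* ((con 1 :+ (con 1 :+ con 0)) :* ε :* n₁)) refl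

  -- Head and tail of a sequence

  module HeadTail {s t : ℕ} (t≤s : t ℕ.≤ s) (a b : Fin s → Carrier) where

    head : (Fin s → Carrier) → Fin t → Carrier
    head f i = f (Fin.inject≤ i t≤s)

    X B₁ Sₕ A B₂ Sₜ : Carrier
    X  = sumFin t (head a)
    B₁ = sumFin t (head b)
    Sₕ = sumFin t (head (λ i → a i * b i))
    A  = sumFrom t s a
    B₂ = sumFrom t s b
    Sₜ = sumFrom t s (λ i → a i * b i)

    module Bounds (m : Carrier) {n₁ n₂ : Carrier} (0<T : 0# < fromℕ t)
      (0≤a : ∀ i → 0# ≤ a i) (0≤b : ∀ i → 0# ≤ b i)
      (m≤head : ∀ i → m ≤ head a i) (tail≤m : ∀ j → t ℕ.≤ toℕ j → a j ≤ m)
      (Σa≈n₁ : sumFin s a ≈ n₁) (Σb≈n₂ : sumFin s b ≈ n₂) (0<N : 0# < (n₁ + n₂))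
      (cap : ∀ i → a i + b i ≤ (n₁ + n₂) / fromℕ t) where

      T M : Carrier
      T = fromℕ t
      M = T * m

      0≤T : 0# ≤ T
      0≤T = proj₁ 0<T

      X+A≈n₁ : X + A ≈ n₁
      X+A≈n₁ = trans (sym (sumFin-split t≤s a)) Σa≈n₁

      B₁+B₂≈n₂ : B₁ + B₂ ≈ n₂
      B₁+B₂≈n₂ = trans (sym (sumFin-split t≤s b)) Σb≈n₂

      n₁′ n₂′ N′ : Carrier
      n₁′ = X + A
      n₂′ = B₁ + B₂
      N′ = n₁′ + n₂′

      N′≈N : N′ ≈ n₁ + n₂
      N′≈N = +-cong X+A≈n₁ B₁+B₂≈n₂

      x y : Fin t → Carrier
      x i = T * head a i
      y i = T * head b i

      cap′ : ∀ i → x i + y i ≤ N′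
      cap′ i = begin
        T * head a i + T * head b i  ≈⟨ distribˡ T (head a i) (head b i) ⟨
        T * (head a i + head b i)    ≤⟨ x≤y/z⇒z*x≤y 0<T (cap _) ⟩
        n₁ + n₂                      ≈⟨ N′≈N ⟨
        N′                           ∎

      Σx≈TX : sumFin t x ≈ T * X
      Σx≈TX = sumFin-*ˡ t T (head a)

      Σy≈TB₁ : sumFin t y ≈ T * B₁
      Σy≈TB₁ = sumFin-*ˡ t T (head b)

      Σxy≈TTSₕ : sumFin t (λ i → x i * y i) ≈ T * (T * Sₕ)
      Σxy≈TTSₕ = begin-equality
        sumFin t (λ i → x i * y i)                           ≈⟨ sumFin-cong t (λ i → Tα*Tβ≈T*[T*αβ] (head a i) (head b i)) ⟩
        sumFin t (λ i → T * (T * (head a i * head b i)))     ≈⟨ sumFin-*ˡ t T _ ⟩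
        T * sumFin t (λ i → T * (head a i * head b i))       ≈⟨ *-congˡ (sumFin-*ˡ t T _) ⟩
        T * (T * Sₕ)                                         ∎
        where
        Tα*Tβ≈T*[T*αβ] : ∀ α β → T * α * (T * β) ≈ T * (T * (α * β))
        Tα*Tβ≈T*[T*αβ] α β = trans (*-assoc T α (T * β)) (*-congˡ (x∙yz≈y∙xz α T β))

      T-distrib : ∀ u v w z e → T * (u * v + w * z + e) ≈ u * (T * v) + w * (T * z) + T * e
      T-distrib u v w z e = solve 6 (λ T u v w z e → T :* (u :* v :+ w :* z :+ e)
        := u :* (T :* v) :+ w :* (T :* z) :+ T :* e) refl T u v w z e

      head-bound-cauchy : N′ * (T * Sₕ) ≤ n₂′ * n₂′ * X + n₁′ * n₁′ * B₁
      head-bound-cauchy = *-cancelˡ-≤-pos 0<T (begin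
        T * (N′ * (T * Sₕ))                                  ≈⟨ x∙yz≈y∙xz T N′ (T * Sₕ) ⟩
        N′ * (T * (T * Sₕ))                                  ≈⟨ *-congˡ Σxy≈TTSₕ ⟨
        N′ * sumFin t (λ i → x i * y i)                      ≤⟨ sum-cap-bound-cauchy t x y (<-respʳ-≈ (sym N′≈N) 0<N)
                                                                 (λ i → *-nonneg 0≤T (0≤a _)) (λ i → *-nonneg 0≤T (0≤b _)) cap′ ⟩
        n₂′ * n₂′ * sumFin t x + n₁′ * n₁′ * sumFin t y      ≈⟨ +-cong (*-congˡ Σx≈TX) (*-congˡ Σy≈TB₁) ⟩
        n₂′ * n₂′ * (T * X) + n₁′ * n₁′ * (T * B₁)           ≈⟨ +-cong (x∙yz≈y∙xz _ T X) (x∙yz≈y∙xz _ T B₁) ⟩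
        T * (n₂′ * n₂′ * X) + T * (n₁′ * n₁′ * B₁)           ≈⟨ distribˡ T _ _ ⟨
        T * (n₂′ * n₂′ * X + n₁′ * n₁′ * B₁)                 ∎)

      head-bound-affine : T * Sₕ + (n₁′ + n₁′) * X + M * N′ ≤ (M + N′) * X + M * B₁ + n₁′ * n₁′
      head-bound-affine = *-cancelˡ-≤-pos 0<T (begin
        T * (T * Sₕ + (n₁′ + n₁′) * X + M * N′)
          ≈⟨ T-distrib T Sₕ (n₁′ + n₁′) X (M * N′) ⟩
        T * (T * Sₕ) + (n₁′ + n₁′) * (T * X) + T * (M * N′)
          ≈⟨ +-congʳ (+-cong Σxy≈TTSₕ (*-congˡ Σx≈TX)) ⟨
        sumFin t (λ i → x i * y i) + (n₁′ + n₁′) * sumFin t x + fromℕ t * (M * N′)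
          ≤⟨ sum-cap-bound-affine t x y n₁′ (λ i → *-monoˡ-≤-nonneg 0≤T (m≤head i)) cap′ ⟩
        (M + N′) * sumFin t x + M * sumFin t y + fromℕ t * (n₁′ * n₁′)
          ≈⟨ +-congʳ (+-cong (*-congˡ Σx≈TX) (*-congˡ Σy≈TB₁)) ⟩
        (M + N′) * (T * X) + M * (T * B₁) + T * (n₁′ * n₁′)
          ≈⟨ T-distrib (M + N′) X M B₁ (n₁′ * n₁′) ⟨
        T * ((M + N′) * X + M * B₁ + n₁′ * n₁′)
          ∎)

      tail-bound : T * Sₜ ≤ M * B₂
      tail-bound = begin
        T * Sₜ        ≤⟨ *-monoˡ-≤-nonneg 0≤T (sumFrom-*-≤ t s a b tail≤m 0≤b) ⟩
        T * (m * B₂)  ≈⟨ *-assoc T m B₂ ⟨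
        M * B₂        ∎

      sum-product-bound : (n₁ + n₂) * (T * sumFin s (λ i → a i * b i)) ≤ n₁ * n₁ * n₂ + n₂ * n₂ * X
      sum-product-bound = begin
        (n₁ + n₂) * (T * sumFin s (λ i → a i * b i))  ≈⟨ *-cong (sym N′≈N) (*-congˡ (sumFin-split t≤s (λ i → a i * b i))) ⟩
        N′ * (T * (Sₕ + Sₜ))                          ≤⟨ key-inequality (sumFin-nonneg t (λ i → 0≤a _)) (sumFrom-nonneg t s 0≤a)
                                                           (sumFin-nonneg t (λ i → 0≤b _)) (sumFrom-nonneg t s 0≤b)
                                                           head-bound-cauchy head-bound-affine tail-bound ⟩
        n₁′ * n₁′ * n₂′ + n₂′ * n₂′ * X               ≈⟨ +-cong (*-cong (*-cong X+A≈n₁ X+A≈n₁) B₁+B₂≈n₂)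
                                                                (*-congʳ (*-cong B₁+B₂≈n₂ B₁+B₂≈n₂)) ⟩
        n₁ * n₁ * n₂ + n₂ * n₂ * X                    ∎

  antitone-head-≥ : ∀ {s t} (t<s : t ℕ.< s) (a : Fin s → Carrier) → (∀ i j → toℕ i ℕ.≤ toℕ j → a j ≤ a i) →
                    ∀ i → a (Fin.fromℕ< t<s) ≤ a (Fin.inject≤ i t<s)
  antitone-head-≥ t<s a antitone i = antitone _ _
    (≡.subst₂ ℕ._≤_ (≡.sym (Finₚ.toℕ-inject≤ i t<s)) (≡.sym (Finₚ.toℕ-fromℕ< t<s)) (Finₚ.toℕ≤pred[n] i))

  antitone-tail-≤ : ∀ {s t} (t<s : t ℕ.< s) (a : Fin s → Carrier) → (∀ i j → toℕ i ℕ.≤ toℕ j → a j ≤ a i) →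
                    ∀ j → suc t ℕ.≤ toℕ j → a j ≤ a (Fin.fromℕ< t<s)
  antitone-tail-≤ t<s a antitone j t<j = antitone _ _
    (≡.subst (ℕ._≤ toℕ j) (≡.sym (Finₚ.toℕ-fromℕ< t<s)) (ℕₚ.<⇒≤ t<j))

lemma2p3 : ∀ {c ℓ₁ ℓ₂ : Level} (F : OrderedField c ℓ₁ ℓ₂) → let open OrderedField F in
    (ε : Carrier) (s t : ℕ) (a b : Fin s → Carrier) (n₁ n₂ : Carrier) →
    0# ≤ ε →
    1 ℕ.≤ t → t ℕ.≤ s →
    (∀ i → 0# ≤ a i) → (∀ i → 0# ≤ b i) →
    (∀ i j → toℕ i ℕ.≤ toℕ j → a j ≤ a i) →
    sumFin s a ≈ n₁ → sumFin s b ≈ n₂ → 0# < n₂ →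
    (∀ i → a i + b i ≤ (n₁ + n₂) / fromℕ t) →
    (1# - ε) * n₁ * n₂ / fromℕ t ≤ sumFin s (λ i → a i * b i) →
    (sumFrom t s a ≤ ε * n₁ * ((n₁ + n₂) / n₂))
    × (n₁ ≤ n₂ → sumFrom t s a ≤ fromℕ 2 * ε * n₁)
lemma2p3 F ε s (suc t) a b n₁ n₂ 0≤ε (s≤s z≤n) t<s 0≤a 0≤b antitone Σa≈n₁ Σb≈n₂ 0<n₂ cap lower =
  ≤-respʳ-≈ (*-assoc (ε * n₁) (n₁ + n₂) (n₂ ⁻¹)) (z*x≤y⇒x≤y/z 0<n₂ n₂A≤εn₁N) ,
  λ n₁≤n₂ → tail-mass-bound-balanced 0<n₂ 0≤ε 0≤n₁ n₁≤n₂ n₂A≤εn₁N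
  where
  open OrderedField F
  open OrderedFieldProperties F
  open HeadTail t<s a b

  0≤n₁ : 0# ≤ n₁
  0≤n₁ = ≤-respʳ-≈ Σa≈n₁ (sumFin-nonneg s 0≤a)

  0<N : 0# < (n₁ + n₂)
  0<N = +-pos 0≤n₁ 0<n₂

  open Bounds (a (Fin.fromℕ< t<s)) (fromℕ-suc-pos t) 0≤a 0≤b
    (antitone-head-≥ t<s a antitone) (antitone-tail-≤ t<s a antitone) Σa≈n₁ Σb≈n₂ 0<N cap

  n₂A≤εn₁N : n₂ * A ≤ ε * n₁ * (n₁ + n₂)
  n₂A≤εn₁N = tail-mass-bound 0<n₂ (proj₁ 0<N) X+A≈n₁ (x/z≤y⇒x≤z*y (fromℕ-suc-pos t) lower) sum-product-bound
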